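{- Let $n>k\ge1$ and $\lambda,\mu\in P_{kn}$. Then, as sets of integers, $$[D_{\min}(\lambda,\mu),D_{\max}(\lambda,\mu)]=\bigcup_{\nu\in P_{kn}}[d_{\min}(\lambda,\mu,\nu),d_{\max}(\lambda,\mu,\nu)].$$
   Context: $P_{kn}$ is the set of partitions $\lambda=(\lambda_1\ge\dots\ge\lambda_k\ge0)$ with $\lambda_1\le n-k$. The 01-word $(\omega_1,\dots,\omega_n)$ of $\lambda$ encodes the boundary path of its Young diagram in the $k\times(n-k)$ rectangle from lower-left to upper-right ($0$ = right step, $1$ = up step); $\phi_i(\lambda)=\omega_1+\dots+\omega_i$ for $1\le i\le n$, extended by $\phi_{i+n}(\lambda)=\phi_i(\lambda)+k$ for all $i\in\mathbb{Z}$. Define $D_{\min}(\lambda,\mu)=-\min_{i+j=0}(\phi_i(\lambda)+\phi_j(\mu))$, $D_{\max}(\lambda,\mu)=-\max_{i+j=k-n}(\phi_i(\lambda)+\phi_j(\mu))$, $d_{\min}(\lambda,\mu,\nu)=-\min_{a+b+c=0}(\phi_a(\lambda)+\phi_b(\mu)+\phi_c(\nu))$, $d_{\max}(\lambda,\mu,\nu)=-\max_{a+b+c=k-n}(\phi_a(\lambda)+\phi_b(\mu)+\phi_c(\nu))$, with extrema over integers satisfying the indicated conditions. $[x,y]$ denotes the set of integers $d$ with $x\le d\le y$ (empty if $x>y$). -}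

module Defs where

open import Data.Nat as ℕ using (ℕ; zero; suc; _∸_)
open import Data.Fin using (Fin; toℕ)
open import Data.Fin.Properties using (any?)
open import Data.Integer as ℤ using (ℤ; +_; 0ℤ; -_)
open import Data.Integer.DivMod using (_/ℕ_; _%ℕ_)
open import Data.Product using (Σ; ∃; ∃-syntax; _×_; _,_)
open import Relation.Binary.PropositionalEquality using (_≡_)
open import Relation.Nullary using (yes; no)

-- An element of P_{kn}: λ = (λ_1 ≥ … ≥ λ_k ≥ 0) with λ_1 ≤ n - k.
-- parts t (t : Fin k, 0-based) is λ_{t+1}.
record Partition (k n : ℕ) : Set where
  field
    parts    : Fin k → ℕ
    antitone : ∀ (s t : Fin k) → toℕ s ℕ.≤ toℕ t → parts t ℕ.≤ parts s
    bounded  : ∀ (t : Fin k) → parts t ℕ.≤ n ∸ k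
open Partition public

-- The 01-word of λ: the boundary path in the k×(n-k) rectangle from the
-- lower-left corner, 0 = right step, 1 = up step.  The up step from height
-- i-1 to height i (i = 1..k) occurs in row i from the bottom, whose length
-- is λ_{k+1-i}; it is therefore step number λ_{k+1-i} + i.  With
-- t = k - i (0-based index of λ_{k+1-i}) this is parts t + (k - t).
ω : ∀ {k n} → Partition k n → ℕ → ℕ
ω {k} λ' j with any? (λ (t : Fin k) → parts λ' t ℕ.+ (k ∸ toℕ t) ℕ.≟ j)
... | yes _ = 1
... | no  _ = 0

φℕ : ∀ {k n} → Partition k n → ℕ → ℕ
φℕ λ' zero    = 0
φℕ λ' (suc i) = φℕ λ' i ℕ.+ ω λ' (suc i)

-- Extension to all integers by φ_{i+n} = φ_i + k:
-- φ_i = φ_{i mod n} + ⌊i / n⌋ · k   (n ≥ 1; for n = 0 the value is irrelevant).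
φ : ∀ {k n} → Partition k n → ℤ → ℤ
φ {k} {zero}  λ' i = 0ℤ
φ {k} {suc m} λ' i = + φℕ λ' (i %ℕ suc m) ℤ.+ (i /ℕ suc m) ℤ.* + k

-- d ∈ [D_min(λ,μ), D_max(λ,μ)], unfolded:
--   D_min ≤ d  ⇔  -d ≤ min_{i+j=0} (φ_i(λ)+φ_j(μ))  ⇔  -d ≤ every such value
--   d ≤ D_max  ⇔  max_{i+j=k-n} (φ_i(λ)+φ_j(μ)) ≤ -d  ⇔  every such value ≤ -d
InD : ∀ {k n} → Partition k n → Partition k n → ℤ → Set
InD {k} {n} λ' μ d =
  (∀ (i j : ℤ) → i ℤ.+ j ≡ 0ℤ → - d ℤ.≤ φ λ' i ℤ.+ φ μ j) ×
  (∀ (i j : ℤ) → i ℤ.+ j ≡ + k ℤ.- + n → φ λ' i ℤ.+ φ μ j ℤ.≤ - d)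

-- d ∈ [d_min(λ,μ,ν), d_max(λ,μ,ν)], unfolded in the same way.
Ind : ∀ {k n} → Partition k n → Partition k n → Partition k n → ℤ → Set
Ind {k} {n} λ' μ ν d =
  (∀ (a b c : ℤ) → a ℤ.+ b ℤ.+ c ≡ 0ℤ →
     - d ℤ.≤ φ λ' a ℤ.+ φ μ b ℤ.+ φ ν c) ×
  (∀ (a b c : ℤ) → a ℤ.+ b ℤ.+ c ≡ + k ℤ.- + n →
     φ λ' a ℤ.+ φ μ b ℤ.+ φ ν c ℤ.≤ - d)

-- Write f = φ λ and g = φ μ. The functions φ ν, ν ∈ P_{kn}, are exactly the staircases ψ : ℤ → ℤ
-- with ψ 0 = 0, ψ (i + 1) - ψ i ∈ {0, 1} and ψ (i + n) = ψ i + k: the up-steps of the lattice path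
-- of ν sit at the positions ν_{t+1} + (k - t), and a staircase is recovered from the positions where
-- it first reaches each height. The extremal convolutions
--   M₀ s = min_a (f a + g (s - a)),   M₁ s = max_a (f a + g (s - a))
-- exist by periodicity, are again staircases, and satisfy M₁ (s + k - n) ≤ M₀ s. Now
-- d ∈ [D_min, D_max] says -d ≤ M₀ 0 and M₁ (k - n) ≤ -d, while d ∈ [d_min, d_max](λ, μ, ν) says
-- L ≤ φ ν ≤ U for the staircases L c = -d - M₀ (-c) and U c = -d - M₁ (k - n - c). As L ≤ U and
-- L 0 ≤ 0 ≤ U 0, clamping f between L and U yields a staircase ψ with ψ 0 = 0, that is, some φ ν.
-- The converse is the case c = 0 of the inequalities defining [d_min, d_max].

module Submission where

open import Defs
open import Data.Nat as ℕ using (ℕ; zero; suc; z≤n; s≤s)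
import Data.Nat.Properties as ℕP
open import Data.Fin as Fin using (Fin; toℕ)
import Data.Fin.Properties as FinP
open import Data.Product using (∃-syntax; _×_; _,_; proj₁; proj₂)
open import Data.Sum using (_⊎_; inj₁; inj₂; [_,_]′; map₁)
open import Data.Empty using (⊥-elim)
open import Function using (_∘_; _⇔_; mk⇔; Equivalence)
open import Relation.Binary.PropositionalEquality
open import Relation.Nullary using (yes; no; ¬_; contradiction)
open import Relation.Unary using (Decidable)
open import Relation.Binary.Definitions using (tri<; tri≈; tri>)

module _ {Q : ℕ → Set} (Q? : Decidable Q) where
  open import Data.Nat using (_≤_; _<_)

  count< : ℕ → ℕ
  count< zero = zero
  count< (suc m) with Q? m
  ... | yes _ = suc (count< m)
  ... | no  _ = count< m

  count<-≤ : ∀ m → count< m ≤ m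
  count<-≤ zero = z≤n
  count<-≤ (suc m) with Q? m
  ... | yes _ = s≤s (count<-≤ m)
  ... | no  _ = ℕP.m≤n⇒m≤1+n (count<-≤ m)

  module _ (Q-down : ∀ {i j} → i ≤ j → Q j → Q i) where

    count<-all : ∀ m → Q m → count< m ≡ m
    count<-all zero _ = refl
    count<-all (suc m) q with Q? m
    ... | yes qm = cong suc (count<-all m qm)
    ... | no ¬qm = contradiction (Q-down (ℕP.n≤1+n m) q) ¬qm

    <-count<⇒ : ∀ {j} m → j < count< m → Q j
    <-count<⇒ (suc m) j< with Q? m
    ... | yes qm = Q-down (ℕP.≤-trans (ℕP.≤-pred j<) (count<-≤ m)) qm
    ... | no  _  = <-count<⇒ m j<

    <-count<⇐ : ∀ {j} m → j < m → Q j → j < count< m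
    <-count<⇐ {j} (suc m) j<1+m qj with Q? m
    ... | yes qm = s≤s (ℕP.≤-trans (ℕP.≤-pred j<1+m) (ℕP.≤-reflexive (sym (count<-all m qm))))
    ... | no ¬qm with ℕP.m≤n⇒m<n∨m≡n (ℕP.≤-pred j<1+m)
    ...   | inj₁ j<m  = <-count<⇐ m j<m qj
    ...   | inj₂ refl = contradiction qj ¬qm

countᶠ : ∀ {k} {P : Fin k → Set} → Decidable P → ℕ
countᶠ {zero}  P? = 0
countᶠ {suc k} P? with P? Fin.zero
... | yes _ = suc (countᶠ (P? ∘ Fin.suc))
... | no  _ = countᶠ (P? ∘ Fin.suc)

countᶠ-none : ∀ {k} {P : Fin k → Set} (P? : Decidable P) → (∀ t → ¬ P t) → countᶠ P? ≡ 0
countᶠ-none {zero}  P? _  = refl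
countᶠ-none {suc k} P? ¬p with P? Fin.zero
... | yes p = contradiction p (¬p Fin.zero)
... | no  _ = countᶠ-none (P? ∘ Fin.suc) (¬p ∘ Fin.suc)

countᶠ-all : ∀ {k} {P : Fin k → Set} (P? : Decidable P) → (∀ t → P t) → countᶠ P? ≡ k
countᶠ-all {zero}  P? _ = refl
countᶠ-all {suc k} P? p with P? Fin.zero
... | yes _  = cong suc (countᶠ-all (P? ∘ Fin.suc) (p ∘ Fin.suc))
... | no ¬p0 = contradiction (p Fin.zero) ¬p0

countᶠ-unique : ∀ {k} {P : Fin k → Set} (P? : Decidable P) {t} →
                P t → (∀ s → P s → s ≡ t) → countᶠ P? ≡ 1
countᶠ-unique {suc k} P? {Fin.zero} p0 unique with P? Fin.zero
... | yes _  = cong suc (countᶠ-none (P? ∘ Fin.suc) (λ s p → FinP.0≢1+n (sym (unique (Fin.suc s) p))))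
... | no ¬p0 = contradiction p0 ¬p0
countᶠ-unique {suc k} P? {Fin.suc t} pt unique with P? Fin.zero
... | yes p0 = contradiction (unique Fin.zero p0) FinP.0≢1+n
... | no  _  = countᶠ-unique (P? ∘ Fin.suc) pt (λ s p → FinP.suc-injective (unique (Fin.suc s) p))

countᶠ-⊎ : ∀ {k} {P Q R : Fin k → Set} (P? : Decidable P) (Q? : Decidable Q) (R? : Decidable R) →
           (∀ t → P t ⇔ (Q t ⊎ R t)) → (∀ t → Q t → ¬ R t) →
           countᶠ P? ≡ countᶠ Q? ℕ.+ countᶠ R?
countᶠ-⊎ {zero}  _ _ _ _ _ = refl
countᶠ-⊎ {suc k} P? Q? R? P⇔Q⊎R Q∩R=∅
  with countᶠ-⊎ (P? ∘ Fin.suc) (Q? ∘ Fin.suc) (R? ∘ Fin.suc) (P⇔Q⊎R ∘ Fin.suc) (Q∩R=∅ ∘ Fin.suc)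
     | P? Fin.zero | Q? Fin.zero | R? Fin.zero
... | _    | _     | yes q | yes r = contradiction r (Q∩R=∅ Fin.zero q)
... | rest | yes _ | yes _ | no  _ = cong suc rest
... | rest | yes _ | no  _ | yes _ = trans (cong suc rest) (sym (ℕP.+-suc _ _))
... | _    | yes p | no ¬q | no ¬r = ⊥-elim ([ ¬q , ¬r ]′ (Equivalence.to (P⇔Q⊎R Fin.zero) p))
... | _    | no ¬p | yes q | _     = contradiction (Equivalence.from (P⇔Q⊎R Fin.zero) (inj₁ q)) ¬p
... | _    | no ¬p | no  _ | yes r = contradiction (Equivalence.from (P⇔Q⊎R Fin.zero) (inj₂ r)) ¬p
... | rest | no  _ | no  _ | no  _ = rest

-- Partitions and lattice paths

module _ {k n : ℕ} (λ' : Partition k n) where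
  open import Data.Nat using (_≤_; _<_; _+_; _∸_; _≟_; _≤?_)
  open import Data.Fin.Properties using (any?)

  upStep : Fin k → ℕ
  upStep t = parts λ' t + (k ∸ toℕ t)

  upStep-decreasing : ∀ {s t} → toℕ s < toℕ t → upStep t < upStep s
  upStep-decreasing {s} {t} s<t =
    ℕP.+-mono-≤-< (antitone λ' s t (ℕP.<⇒≤ s<t)) (ℕP.∸-monoʳ-< s<t (ℕP.<⇒≤ (FinP.toℕ<n t)))

  upStep-injective : ∀ {s t} → upStep s ≡ upStep t → s ≡ t
  upStep-injective {s} {t} eq with ℕP.<-cmp (toℕ s) (toℕ t)
  ... | tri< s<t _ _ = contradiction (sym eq) (ℕP.<⇒≢ (upStep-decreasing s<t))
  ... | tri≈ _ s≡t _ = FinP.toℕ-injective s≡t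
  ... | tri> _ _ t<s = contradiction eq (ℕP.<⇒≢ (upStep-decreasing t<s))

  upStep-positive : ∀ t → 0 < upStep t
  upStep-positive t = ℕP.<-≤-trans (ℕP.m<n⇒0<n∸m (FinP.toℕ<n t)) (ℕP.m≤n+m _ (parts λ' t))

  upStep-≤ : k ≤ n → ∀ t → upStep t ≤ n
  upStep-≤ k≤n t = begin
    parts λ' t + (k ∸ toℕ t) ≤⟨ ℕP.+-mono-≤ (bounded λ' t) (ℕP.m∸n≤m k (toℕ t)) ⟩
    (n ∸ k) + k              ≡⟨ ℕP.m∸n+n≡m k≤n ⟩
    n                        ∎
    where open ℕP.≤-Reasoning

  ω≡countᶠ : ∀ j → ω λ' j ≡ countᶠ (λ t → upStep t ≟ j)
  ω≡countᶠ j with any? (λ t → upStep t ≟ j)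
  ... | yes (t , eq) = sym (countᶠ-unique (λ t → upStep t ≟ j) eq
                              (λ s eq′ → upStep-injective (trans eq′ (sym eq))))
  ... | no ∄t        = sym (countᶠ-none (λ t → upStep t ≟ j) (λ t eq → ∄t (t , eq)))

  ω≡1 : ∀ {t j} → upStep t ≡ j → ω λ' j ≡ 1
  ω≡1 {t} {j} eq with any? (λ t → upStep t ≟ j)
  ... | yes _  = refl
  ... | no ∄t  = contradiction (t , eq) ∄t

  ω≡0 : ∀ {j} → (∀ t → upStep t ≢ j) → ω λ' j ≡ 0
  ω≡0 {j} ≢j with any? (λ t → upStep t ≟ j)
  ... | yes (t , eq) = contradiction eq (≢j t)
  ... | no  _        = refl

  ω≤1 : ∀ j → ω λ' j ≤ 1
  ω≤1 j with any? (λ t → upStep t ≟ j)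
  ... | yes _ = ℕP.≤-refl
  ... | no  _ = z≤n

  φℕ-mono : ∀ j → φℕ λ' j ≤ φℕ λ' (suc j)
  φℕ-mono j = ℕP.m≤m+n (φℕ λ' j) (ω λ' (suc j))

  φℕ-step≤1 : ∀ j → φℕ λ' (suc j) ≤ suc (φℕ λ' j)
  φℕ-step≤1 j =
    subst (φℕ λ' (suc j) ≤_) (ℕP.+-comm (φℕ λ' j) 1) (ℕP.+-monoʳ-≤ (φℕ λ' j) (ω≤1 (suc j)))

  φℕ≡countᶠ : ∀ j → φℕ λ' j ≡ countᶠ (λ t → upStep t ≤? j)
  φℕ≡countᶠ zero    = sym (countᶠ-none (λ t → upStep t ≤? 0) (λ t → ℕP.<⇒≱ (upStep-positive t)))
  φℕ≡countᶠ (suc j) = begin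
    φℕ λ' j + ω λ' (suc j)
      ≡⟨ cong₂ _+_ (φℕ≡countᶠ j) (ω≡countᶠ (suc j)) ⟩
    countᶠ (λ t → upStep t ≤? j) + countᶠ (λ t → upStep t ≟ suc j)
      ≡⟨ countᶠ-⊎ _ _ _ split disjoint ⟨
    countᶠ (λ t → upStep t ≤? suc j)
      ∎
    where
      open ≡-Reasoning
      split : ∀ t → upStep t ≤ suc j ⇔ (upStep t ≤ j ⊎ upStep t ≡ suc j)
      split t = mk⇔ (map₁ ℕP.≤-pred ∘ ℕP.m≤n⇒m<n∨m≡n) [ ℕP.m≤n⇒m≤1+n , ℕP.≤-reflexive ]′
      disjoint : ∀ t → upStep t ≤ j → upStep t ≢ suc j
      disjoint t ≤j eq = ℕP.1+n≰n (subst (_≤ j) eq ≤j)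

  φℕ-n : k ≤ n → φℕ λ' n ≡ k
  φℕ-n k≤n = trans (φℕ≡countᶠ n) (countᶠ-all (λ t → upStep t ≤? n) (upStep-≤ k≤n))

mono-from-steps : ∀ {g : ℕ → ℕ} {m} → (∀ {j} → suc j ℕ.≤ m → g j ℕ.≤ g (suc j)) →
                  ∀ {i j} → i ℕ.≤ j → j ℕ.≤ m → g i ℕ.≤ g j
mono-from-steps step {j = zero}  z≤n _ = ℕP.≤-refl
mono-from-steps step {j = suc j} i≤1+j 1+j≤m with ℕP.m≤n⇒m<n∨m≡n i≤1+j
... | inj₁ i<1+j = ℕP.≤-trans (mono-from-steps step (ℕP.≤-pred i<1+j) (ℕP.<⇒≤ 1+j≤m)) (step 1+j≤m)
... | inj₂ refl  = ℕP.≤-refl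

module LatticePath {k n : ℕ} (k≤n : k ℕ.≤ n) (F : ℕ → ℕ) (F-0 : F 0 ≡ 0)
    (F-mono : ∀ j → F j ℕ.≤ F (suc j)) (F-step : ∀ j → F (suc j) ℕ.≤ suc (F j)) (F-n : F n ≡ k) where
  open import Data.Nat using (_≤_; _<_; _+_; _∸_; _<?_)

  F-monotone : ∀ {i j} → i ≤ j → F i ≤ F j
  F-monotone i≤j = mono-from-steps (λ _ → F-mono _) i≤j ℕP.≤-refl

  F-+ : ∀ i d → F (i + d) ≤ F i + d
  F-+ i zero    rewrite ℕP.+-identityʳ i | ℕP.+-identityʳ (F i) = ℕP.≤-refl
  F-+ i (suc d) rewrite ℕP.+-suc i d   | ℕP.+-suc (F i) d     = ℕP.≤-trans (F-step (i + d)) (s≤s (F-+ i d))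

  F≤id : ∀ j → F j ≤ j
  F≤id j = subst (λ x → F j ≤ x + j) F-0 (F-+ 0 j)

  -- The least j with c ≤ F j: as F is monotone, the j < n with F j < c form an initial segment.
  firstReach : ℕ → ℕ
  firstReach c = count< (λ j → F j <? c) n

  private
    below-down : ∀ {c i j} → i ≤ j → F j < c → F i < c
    below-down i≤j = ℕP.≤-<-trans (F-monotone i≤j)

  firstReach-≤⇔ : ∀ {c j} → c ≤ k → j ≤ n → firstReach c ≤ j ⇔ c ≤ F j
  firstReach-≤⇔ {c} {j} c≤k j≤n = mk⇔ to from
    where
      to : firstReach c ≤ j → c ≤ F j
      to fr≤j with ℕP.m≤n⇒m<n∨m≡n j≤n
      ... | inj₁ j<n  =
        ℕP.≮⇒≥ (λ Fj<c → ℕP.<⇒≱ (<-count<⇐ (λ j → F j <? c) below-down n j<n Fj<c) fr≤j)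
      ... | inj₂ refl = subst (c ≤_) (sym F-n) c≤k
      from : c ≤ F j → firstReach c ≤ j
      from c≤Fj = ℕP.≮⇒≥ (λ j<fr → ℕP.<⇒≱ (<-count<⇒ (λ j → F j <? c) below-down n j<fr) c≤Fj)

  ≤-firstReach : ∀ {c} → c ≤ k → c ≤ firstReach c
  ≤-firstReach c≤k =
    ℕP.≤-trans (Equivalence.to (firstReach-≤⇔ c≤k (count<-≤ _ n)) ℕP.≤-refl) (F≤id _)

  firstReach-< : ∀ {c} → suc c ≤ k → firstReach c < firstReach (suc c)
  firstReach-< {c} 1+c≤k = below (≤-firstReach 1+c≤k) (count<-≤ _ n)
    (Equivalence.to (firstReach-≤⇔ 1+c≤k (count<-≤ _ n)) ℕP.≤-refl)
    where
      below : ∀ {j} → suc c ≤ j → j ≤ n → suc c ≤ F j → firstReach c < j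
      below {suc j} _ j<n 1+c≤Fj = s≤s (Equivalence.from (firstReach-≤⇔ (ℕP.<⇒≤ 1+c≤k) (ℕP.<⇒≤ j<n))
                                          (ℕP.≤-pred (ℕP.≤-trans 1+c≤Fj (F-step j))))

  firstReach-∸-mono : ∀ {c c′} → c ≤ c′ → c′ ≤ k → firstReach c ∸ c ≤ firstReach c′ ∸ c′
  firstReach-∸-mono = mono-from-steps (λ {c} 1+c≤k → ℕP.∸-monoˡ-≤ (suc c) (firstReach-< 1+c≤k))

  firstReach-bounded : ∀ {c} → c ≤ k → firstReach c ≤ c + (n ∸ k)
  firstReach-bounded {c} c≤k = Equivalence.from (firstReach-≤⇔ c≤k j≤n) c≤Fj
    where
      j = c + (n ∸ k)
      j≤n : j ≤ n
      j≤n = ℕP.≤-trans (ℕP.+-monoˡ-≤ (n ∸ k) c≤k) (ℕP.≤-reflexive (ℕP.m+[n∸m]≡n k≤n))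
      j+[k∸c]≡n : j + (k ∸ c) ≡ n
      j+[k∸c]≡n = begin
        c + (n ∸ k) + (k ∸ c) ≡⟨ cong (_+ (k ∸ c)) (ℕP.+-comm c (n ∸ k)) ⟩
        n ∸ k + c + (k ∸ c)   ≡⟨ ℕP.+-assoc (n ∸ k) c (k ∸ c) ⟩
        n ∸ k + (c + (k ∸ c)) ≡⟨ cong (n ∸ k +_) (ℕP.m+[n∸m]≡n c≤k) ⟩
        n ∸ k + k             ≡⟨ ℕP.m∸n+n≡m k≤n ⟩
        n                     ∎
        where open ≡-Reasoning
      k≤Fj+[k∸c] : k ≤ F j + (k ∸ c)
      k≤Fj+[k∸c] = subst (_≤ F j + (k ∸ c)) (trans (cong F j+[k∸c]≡n) F-n) (F-+ j (k ∸ c))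
      c≤Fj : c ≤ F j
      c≤Fj = subst (_≤ F j) (ℕP.m∸[m∸n]≡n c≤k)
               (ℕP.m≤n+o⇒m∸n≤o k (k ∸ c) (subst (k ≤_) (ℕP.+-comm (F j) (k ∸ c)) k≤Fj+[k∸c]))

  level : Fin k → ℕ
  level t = k ∸ toℕ t

  level≤k : ∀ t → level t ≤ k
  level≤k t = ℕP.m∸n≤m k (toℕ t)

  pathPartition : Partition k n
  pathPartition = record
    { parts    = λ t → firstReach (level t) ∸ level t
    ; antitone = λ s t s≤t → firstReach-∸-mono (ℕP.∸-monoʳ-≤ k s≤t) (level≤k s)
    ; bounded  = λ t → ℕP.m≤n+o⇒m∸n≤o _ (level t) (firstReach-bounded (level≤k t))
    }

  upStep-pathPartition : ∀ t → upStep pathPartition t ≡ firstReach (level t)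
  upStep-pathPartition t = ℕP.m∸n+n≡m (≤-firstReach (level≤k t))

  upStep-at-rise : ∀ {j} → suc j ≤ n → F j < F (suc j) → ∃[ t ] upStep pathPartition t ≡ suc j
  upStep-at-rise {j} 1+j≤n Fj<F1+j = t , trans (upStep-pathPartition t) (trans (cong firstReach level-t) firstReach-c)
    where
      c = F (suc j)
      c≤k : c ≤ k
      c≤k = subst (c ≤_) F-n (F-monotone 1+j≤n)
      k∸c<k : k ∸ c < k
      k∸c<k = ℕP.∸-monoʳ-< {k} {c} {0} (ℕP.≤-<-trans z≤n Fj<F1+j) c≤k
      t : Fin k
      t = Fin.fromℕ< k∸c<k
      level-t : level t ≡ c
      level-t = trans (cong (k ∸_) (FinP.toℕ-fromℕ< k∸c<k)) (ℕP.m∸[m∸n]≡n c≤k)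
      firstReach-c : firstReach c ≡ suc j
      firstReach-c = ℕP.≤-antisym (Equivalence.from (firstReach-≤⇔ c≤k 1+j≤n) ℕP.≤-refl)
        (ℕP.≰⇒> (λ fr≤j → ℕP.<⇒≱ Fj<F1+j (Equivalence.to (firstReach-≤⇔ c≤k (ℕP.<⇒≤ 1+j≤n)) fr≤j)))

  no-upStep-at-flat : ∀ {j} → suc j ≤ n → F j ≡ F (suc j) → ∀ t → upStep pathPartition t ≢ suc j
  no-upStep-at-flat {j} 1+j≤n Fj≡F1+j t eq = ℕP.1+n≰n (ℕP.≤-trans (ℕP.≤-reflexive (sym fr≡1+j)) fr≤j)
    where
      fr≡1+j : firstReach (level t) ≡ suc j
      fr≡1+j = trans (sym (upStep-pathPartition t)) eq
      c≤F1+j : level t ≤ F (suc j)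
      c≤F1+j = Equivalence.to (firstReach-≤⇔ (level≤k t) 1+j≤n) (ℕP.≤-reflexive fr≡1+j)
      fr≤j : firstReach (level t) ≤ j
      fr≤j = Equivalence.from (firstReach-≤⇔ (level≤k t) (ℕP.<⇒≤ 1+j≤n))
               (subst (level t ≤_) (sym Fj≡F1+j) c≤F1+j)

  φℕ-pathPartition : ∀ j → j ≤ n → φℕ pathPartition j ≡ F j
  φℕ-pathPartition zero    _     = sym F-0
  φℕ-pathPartition (suc j) 1+j≤n with ℕP.m≤n⇒m<n∨m≡n (F-mono j)
  ... | inj₁ Fj<F1+j = begin
    φℕ pathPartition j + ω pathPartition (suc j) ≡⟨ cong₂ _+_ IH ω≡1′ ⟩
    F j + 1                                     ≡⟨ ℕP.+-comm (F j) 1 ⟩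
    suc (F j)                                   ≡⟨ ℕP.≤-antisym (F-step j) Fj<F1+j ⟨
    F (suc j)                                   ∎
    where
      open ≡-Reasoning
      IH = φℕ-pathPartition j (ℕP.<⇒≤ 1+j≤n)
      rise = upStep-at-rise 1+j≤n Fj<F1+j
      ω≡1′ = ω≡1 pathPartition {proj₁ rise} (proj₂ rise)
  ... | inj₂ Fj≡F1+j = begin
    φℕ pathPartition j + ω pathPartition (suc j) ≡⟨ cong₂ _+_ IH ω≡0′ ⟩
    F j + 0                                     ≡⟨ ℕP.+-identityʳ (F j) ⟩
    F j                                         ≡⟨ Fj≡F1+j ⟩
    F (suc j)                                   ∎
    where
      open ≡-Reasoning
      IH = φℕ-pathPartition j (ℕP.<⇒≤ 1+j≤n)
      ω≡0′ = ω≡0 pathPartition (no-upStep-at-flat 1+j≤n Fj≡F1+j)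

-- Staircases

module _ where
  open import Data.Integer
    using (ℤ; +_; -[1+_]; 0ℤ; 1ℤ; -1ℤ; -_; _+_; _-_; _*_; _≤_; _<_; _⊓_; _⊔_; ∣_∣; +≤+; +<+; _%ℕ_; _/ℕ_)
    renaming (suc to sucℤ)
  open import Data.Integer.Properties
  open import Data.Integer.DivMod using (a≡a%ℕn+[a/ℕn]*n; n%ℕd<d)
  open import Data.Integer.Tactic.RingSolver using (solve-∀)

  module _ {f : ℤ → ℤ} {N K : ℤ} (shift : ∀ i → f (i + N) ≡ f i + K) where

    quasiPeriodic-+ : ∀ i t → f (i + + t * N) ≡ f i + + t * K
    quasiPeriodic-+ i zero    = trans (cong f (+-identityʳ i)) (sym (+-identityʳ (f i)))
    quasiPeriodic-+ i (suc t) = begin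
      f (i + (1ℤ + + t) * N) ≡⟨ cong f (eq i (+ t) N) ⟩
      f (i + + t * N + N)    ≡⟨ shift _ ⟩
      f (i + + t * N) + K    ≡⟨ cong (_+ K) (quasiPeriodic-+ i t) ⟩
      f i + + t * K + K      ≡⟨ eq (f i) (+ t) K ⟨
      f i + (1ℤ + + t) * K   ∎
      where
        open ≡-Reasoning
        eq : ∀ i t N → i + (1ℤ + t) * N ≡ i + t * N + N
        eq = solve-∀

    quasiPeriodic-* : ∀ i q → f (i + q * N) ≡ f i + q * K
    quasiPeriodic-* i (+ t)      = quasiPeriodic-+ i t
    quasiPeriodic-* i -[1+ t ] = begin
      f (i + - q * N)                 ≡⟨ eq₁ (f (i + - q * N)) (q * K) ⟩
      f (i + - q * N) + q * K - q * K ≡⟨ cong (_- q * K) (quasiPeriodic-+ (i + - q * N) (suc t)) ⟨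
      f (i + - q * N + q * N) - q * K ≡⟨ cong (λ x → f x - q * K) (eq₂ i q N) ⟩
      f i - q * K                     ≡⟨ eq₃ (f i) q K ⟩
      f i + - q * K                   ∎
      where
        open ≡-Reasoning
        q = + suc t
        eq₁ : ∀ x y → x ≡ x + y - y
        eq₁ = solve-∀
        eq₂ : ∀ i q N → i + - q * N + q * N ≡ i
        eq₂ = solve-∀
        eq₃ : ∀ x q K → x - q * K ≡ x + - q * K
        eq₃ = solve-∀

  module _ {n} .{{_ : ℕ.NonZero n}} where

    private
      below-next-multiple : ∀ {r r′ q q′} → r ℕ.< n → q < q′ → + r + q * + n < + r′ + q′ * + n
      below-next-multiple {r} {r′} {q} {q′} r<n q<q′ = begin-strict
        + r + q * + n   <⟨ +-monoˡ-< (q * + n) (+<+ r<n) ⟩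
        + n + q * + n   ≡⟨ eq (+ n) q ⟩
        (1ℤ + q) * + n  ≤⟨ *-monoʳ-≤-nonNeg (+ n) (i<j⇒suc[i]≤j q<q′) ⟩
        q′ * + n        ≤⟨ i≤j+i (q′ * + n) (+ r′) ⟩
        + r′ + q′ * + n ∎
        where
          open ≤-Reasoning
          eq : ∀ n q → n + q * n ≡ (1ℤ + q) * n
          eq = solve-∀

    /ℕ-%ℕ-unique : ∀ {i r q} → r ℕ.< n → i ≡ + r + q * + n → i %ℕ n ≡ r × i /ℕ n ≡ q
    /ℕ-%ℕ-unique {i} {r} {q} r<n i≡r+qn = +-injective r′≡r , sym q≡q′
      where
        r′ = i %ℕ n
        q′ = i /ℕ n
        r′+q′n≡r+qn : + r′ + q′ * + n ≡ + r + q * + n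
        r′+q′n≡r+qn = trans (sym (a≡a%ℕn+[a/ℕn]*n i n)) i≡r+qn
        q≡q′ : q ≡ q′
        q≡q′ with <-cmp q q′
        ... | tri< q<q′ _ _ = contradiction (sym r′+q′n≡r+qn) (<⇒≢ (below-next-multiple r<n q<q′))
        ... | tri≈ _ q≡q′ _ = q≡q′
        ... | tri> _ _ q′<q = contradiction r′+q′n≡r+qn (<⇒≢ (below-next-multiple (n%ℕd<d i n) q′<q))
        r′≡r : + r′ ≡ + r
        r′≡r = begin
          + r′                          ≡⟨ eq (+ r′) (q′ * + n) ⟩
          + r′ + q′ * + n - q′ * + n    ≡⟨ cong₂ (λ x y → x - y * + n) r′+q′n≡r+qn (sym q≡q′) ⟩
          + r + q * + n - q * + n       ≡⟨ eq (+ r) (q * + n) ⟨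
          + r                           ∎
          where
            open ≡-Reasoning
            eq : ∀ x y → x ≡ x + y - y
            eq = solve-∀

  record IsStaircase (n k : ℕ) (f : ℤ → ℤ) : Set where
    field
      mono   : ∀ i → f i ≤ f (sucℤ i)
      step≤1 : ∀ i → f (sucℤ i) ≤ sucℤ (f i)
      shift  : ∀ i → f (i + + n) ≡ f i + + k

  module _ (n k : ℕ) .{{_ : ℕ.NonZero n}} where

    extend : (ℕ → ℕ) → ℤ → ℤ
    extend F i = + F (i %ℕ n) + (i /ℕ n) * + k

    extend-at : ∀ F {r} q → r ℕ.< n → extend F (+ r + q * + n) ≡ + F r + q * + k
    extend-at F {r} q r<n = cong₂ (λ r q → + F r + q * + k) (proj₁ unique) (proj₂ unique)
      where unique = /ℕ-%ℕ-unique {i = + r + q * + n} {q = q} r<n refl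

    extend-at-≤ : ∀ F → F 0 ≡ 0 → F n ≡ k →
                  ∀ {r} q → r ℕ.≤ n → extend F (+ r + q * + n) ≡ + F r + q * + k
    extend-at-≤ F F-0 F-n {r} q r≤n with ℕP.m≤n⇒m<n∨m≡n r≤n
    ... | inj₁ r<n  = extend-at F q r<n
    ... | inj₂ refl = begin
      extend F (+ n + q * + n)       ≡⟨ cong (extend F) (eq₁ (+ n) q) ⟩
      extend F (0ℤ + (q + 1ℤ) * + n) ≡⟨ extend-at F (q + 1ℤ) (ℕ.>-nonZero⁻¹ n) ⟩
      + F 0 + (q + 1ℤ) * + k       ≡⟨ cong (λ x → + x + (q + 1ℤ) * + k) F-0 ⟩
      0ℤ + (q + 1ℤ) * + k          ≡⟨ eq₁ (+ k) q ⟨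
      + k + q * + k                ≡⟨ cong (λ x → + x + q * + k) F-n ⟨
      + F n + q * + k              ∎
      where
        open ≡-Reasoning
        eq₁ : ∀ n q → n + q * n ≡ 0ℤ + (q + 1ℤ) * n
        eq₁ = solve-∀

    extend-staircase : ∀ {F} → F 0 ≡ 0 → F n ≡ k → (∀ j → F j ℕ.≤ F (suc j)) →
                       (∀ j → F (suc j) ℕ.≤ suc (F j)) → IsStaircase n k (extend F)
    extend-staircase {F} F-0 F-n F-mono F-step = record
      { mono   = λ i → subst (extend F i ≤_) (sym (extend-sucℤ i)) (+-monoˡ-≤ (q i * + k) (+≤+ (F-mono (r i))))
      ; step≤1 = λ i → subst (_≤ sucℤ (extend F i)) (sym (extend-sucℤ i))
                         (≤-trans (+-monoˡ-≤ (q i * + k) (+≤+ (F-step (r i))))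
                                  (≤-reflexive (+-assoc 1ℤ (+ F (r i)) (q i * + k))))
      ; shift  = λ i → begin
          extend F (i + + n)                      ≡⟨ cong (λ i → extend F (i + + n)) (decompose i) ⟩
          extend F (+ r i + q i * + n + + n)      ≡⟨ cong (extend F) (next-multiple (+ r i) (q i) (+ n)) ⟩
          extend F (+ r i + (q i + 1ℤ) * + n)     ≡⟨ extend-at F (q i + 1ℤ) (n%ℕd<d i n) ⟩
          + F (r i) + (q i + 1ℤ) * + k            ≡⟨ next-multiple (+ F (r i)) (q i) (+ k) ⟨
          extend F i + + k                        ∎
      }
      where
        open ≡-Reasoning
        r : ℤ → ℕ
        r i = i %ℕ n
        q : ℤ → ℤ
        q i = i /ℕ n
        decompose : ∀ i → i ≡ + r i + q i * + n
        decompose i = a≡a%ℕn+[a/ℕn]*n i n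
        next-multiple : ∀ r q n → r + q * n + n ≡ r + (q + 1ℤ) * n
        next-multiple = solve-∀
        extend-sucℤ : ∀ i → extend F (sucℤ i) ≡ + F (suc (r i)) + q i * + k
        extend-sucℤ i = begin
          extend F (1ℤ + i)                   ≡⟨ cong (λ i → extend F (1ℤ + i)) (decompose i) ⟩
          extend F (1ℤ + (+ r i + q i * + n)) ≡⟨ cong (extend F) (sym (+-assoc 1ℤ (+ r i) (q i * + n))) ⟩
          extend F (+ suc (r i) + q i * + n)  ≡⟨ extend-at-≤ F F-0 F-n (q i) (n%ℕd<d i n) ⟩
          + F (suc (r i)) + q i * + k         ∎

  module Staircase {n k : ℕ} {f : ℤ → ℤ} (S : IsStaircase n k f) where
    open IsStaircase S public

    shift-* : ∀ i q → f (i + q * + n) ≡ f i + q * + k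
    shift-* = quasiPeriodic-* {f} shift

    private
      +-sucʳ : ∀ i t → i + (1ℤ + t) ≡ 1ℤ + (i + t)
      +-sucʳ = solve-∀

    mono-+ : ∀ i {t} → 0ℤ ≤ t → f i ≤ f (i + t)
    mono-+ i (+≤+ {n = t} z≤n) = go t
      where
        go : ∀ t → f i ≤ f (i + + t)
        go zero    = ≤-reflexive (cong f (sym (+-identityʳ i)))
        go (suc t) = ≤-trans (go t) (≤-trans (mono (i + + t)) (≤-reflexive (cong f (sym (+-sucʳ i (+ t))))))

    slope-+ : ∀ i {t} → 0ℤ ≤ t → f (i + t) ≤ f i + t
    slope-+ i (+≤+ {n = t} z≤n) = go t
      where
        go : ∀ t → f (i + + t) ≤ f i + + t
        go zero    = ≤-reflexive (trans (cong f (+-identityʳ i)) (sym (+-identityʳ (f i))))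
        go (suc t) = begin
          f (i + (1ℤ + + t)) ≡⟨ cong f (+-sucʳ i (+ t)) ⟩
          f (sucℤ (i + + t)) ≤⟨ step≤1 (i + + t) ⟩
          sucℤ (f (i + + t)) ≤⟨ +-monoʳ-≤ 1ℤ (go t) ⟩
          sucℤ (f i + + t)   ≡⟨ +-sucʳ (f i) (+ t) ⟨
          f i + (1ℤ + + t)   ∎
          where open ≤-Reasoning

  -- Extremal convolutions

  module _ (n : ℕ) .{{_ : ℕ.NonZero n}} where
    open import Data.List using (upTo)
    open import Data.List.Extrema ≤-totalOrder using (argmin; argmax; f[argmin]≤f[xs]; f[xs]≤f[argmax])
    open import Data.List.Relation.Unary.All using (lookup)
    open import Data.List.Membership.Propositional.Properties using (∈-upTo⁺)

    periodic-%ℕ : ∀ {h : ℤ → ℤ} → (∀ a → h (a + + n) ≡ h a) → ∀ a → h a ≡ h (+ (a %ℕ n))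
    periodic-%ℕ {h} periodic a = begin
      h a                               ≡⟨ cong h (a≡a%ℕn+[a/ℕn]*n a n) ⟩
      h (+ (a %ℕ n) + (a /ℕ n) * + n)   ≡⟨ quasiPeriodic-* {h} periodic′ (+ (a %ℕ n)) (a /ℕ n) ⟩
      h (+ (a %ℕ n)) + (a /ℕ n) * 0ℤ    ≡⟨ cong (λ x → h (+ (a %ℕ n)) + x) (*-zeroʳ (a /ℕ n)) ⟩
      h (+ (a %ℕ n)) + 0ℤ               ≡⟨ +-identityʳ _ ⟩
      h (+ (a %ℕ n))                    ∎
      where
        open ≡-Reasoning
        periodic′ : ∀ a → h (a + + n) ≡ h a + 0ℤ
        periodic′ a = trans (periodic a) (sym (+-identityʳ (h a)))

    argminPeriodic argmaxPeriodic : (ℤ → ℤ) → ℤ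
    argminPeriodic h = + argmin (h ∘ +_) 0 (upTo n)
    argmaxPeriodic h = + argmax (h ∘ +_) 0 (upTo n)

    module _ {h : ℤ → ℤ} (periodic : ∀ a → h (a + + n) ≡ h a) where

      argminPeriodic-≤ : ∀ a → h (argminPeriodic h) ≤ h a
      argminPeriodic-≤ a = subst (h (argminPeriodic h) ≤_) (sym (periodic-%ℕ periodic a))
        (lookup (f[argmin]≤f[xs] {f = h ∘ +_} 0 (upTo n)) (∈-upTo⁺ (n%ℕd<d a n)))

      ≤-argmaxPeriodic : ∀ a → h a ≤ h (argmaxPeriodic h)
      ≤-argmaxPeriodic a = subst (_≤ h (argmaxPeriodic h)) (sym (periodic-%ℕ periodic a))
        (lookup (f[xs]≤f[argmax] {f = h ∘ +_} 0 (upTo n)) (∈-upTo⁺ (n%ℕd<d a n)))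

  module Convolution {n k} .{{_ : ℕ.NonZero n}} {f g : ℤ → ℤ} (Sf : IsStaircase n k f) (Sg : IsStaircase n k g) where
    private
      module F = Staircase Sf
      module G = Staircase Sg

    conv : ℤ → ℤ → ℤ
    conv s a = f a + g (s - a)

    conv-periodic : ∀ s a → conv s (a + + n) ≡ conv s a
    conv-periodic s a = begin
      f (a + + n) + g (s - (a + + n))       ≡⟨ cong₂ _+_ (F.shift a) (cong g (eq₁ s a (+ n))) ⟩
      f a + + k + g (s - a + -1ℤ * + n)     ≡⟨ cong (λ x → f a + + k + x) (G.shift-* (s - a) -1ℤ) ⟩
      f a + + k + (g (s - a) + -1ℤ * + k)   ≡⟨ eq₂ (f a) (g (s - a)) (+ k) ⟩
      f a + g (s - a)                       ∎
      where
        open ≡-Reasoning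
        eq₁ : ∀ s a n → s - (a + n) ≡ s - a + -1ℤ * n
        eq₁ = solve-∀
        eq₂ : ∀ x y k → x + k + (y + -1ℤ * k) ≡ x + y
        eq₂ = solve-∀

    minConv maxConv : ℤ → ℤ
    minConv s = conv s (argminPeriodic n (conv s))
    maxConv s = conv s (argmaxPeriodic n (conv s))

    minConv-≤ : ∀ s a → minConv s ≤ conv s a
    minConv-≤ s = argminPeriodic-≤ n (conv-periodic s)

    ≤-maxConv : ∀ s a → conv s a ≤ maxConv s
    ≤-maxConv s = ≤-argmaxPeriodic n (conv-periodic s)

    private
      suc-∸ : ∀ s a → 1ℤ + (s - a) ≡ 1ℤ + s - a
      suc-∸ = solve-∀

    conv-mono : ∀ s a → conv s a ≤ conv (sucℤ s) a
    conv-mono s a = +-monoʳ-≤ (f a) (subst (λ x → g (s - a) ≤ g x) (suc-∸ s a) (G.mono (s - a)))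

    conv-step : ∀ s a → conv (sucℤ s) a ≤ conv s a + 1ℤ
    conv-step s a = begin
      f a + g (1ℤ + s - a)    ≡⟨ cong (λ x → f a + g x) (suc-∸ s a) ⟨
      f a + g (1ℤ + (s - a))  ≤⟨ +-monoʳ-≤ (f a) (G.step≤1 (s - a)) ⟩
      f a + (1ℤ + g (s - a))  ≡⟨ eq (f a) (g (s - a)) ⟩
      f a + g (s - a) + 1ℤ    ∎
      where
        open ≤-Reasoning
        eq : ∀ x y → x + (1ℤ + y) ≡ x + y + 1ℤ
        eq = solve-∀

    conv-shift : ∀ s a → conv (s + + n) a ≡ conv s a + + k
    conv-shift s a = begin
      f a + g (s + + n - a)   ≡⟨ cong (λ x → f a + g x) (eq₁ s (+ n) a) ⟩
      f a + g (s - a + + n)   ≡⟨ cong (λ x → f a + x) (G.shift (s - a)) ⟩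
      f a + (g (s - a) + + k) ≡⟨ +-assoc (f a) (g (s - a)) (+ k) ⟨
      f a + g (s - a) + + k   ∎
      where
        open ≡-Reasoning
        eq₁ : ∀ s n a → s + n - a ≡ s - a + n
        eq₁ = solve-∀

    extremum-staircase : ∀ {E : ℤ → ℤ} →
                         (∀ {s s′} C → (∀ a → conv s a ≤ conv s′ a + C) → E s ≤ E s′ + C) →
                         IsStaircase n k E
    extremum-staircase {E} E-mono = record
      { mono   = λ s → subst (E s ≤_) (+-identityʳ _)
                         (E-mono 0ℤ λ a → subst (conv s a ≤_) (sym (+-identityʳ _)) (conv-mono s a))
      ; step≤1 = λ s → subst (E (sucℤ s) ≤_) (+-comm (E s) 1ℤ) (E-mono {s′ = s} 1ℤ (conv-step s))
      ; shift  = λ s → ≤-antisym (E-mono (+ k) (≤-reflexive ∘ conv-shift s)) (E[s]+k≤E[s+n] s)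
      }
      where
        open ≤-Reasoning
        eq : ∀ x k → x ≡ x + k - k
        eq = solve-∀
        eq′ : ∀ x k → x - k + k ≡ x
        eq′ = solve-∀
        E[s]+k≤E[s+n] : ∀ s → E s + + k ≤ E (s + + n)
        E[s]+k≤E[s+n] s = begin
          E s + + k               ≤⟨ +-monoˡ-≤ (+ k) (E-mono (- + k) λ a →
                                       ≤-reflexive (trans (eq (conv s a) (+ k)) (cong (_- + k) (sym (conv-shift s a))))) ⟩
          E (s + + n) - + k + + k ≡⟨ eq′ (E (s + + n)) (+ k) ⟩
          E (s + + n)             ∎

    minConv-staircase : IsStaircase n k minConv
    minConv-staircase = extremum-staircase λ {s} {s′} C pointwise →
      ≤-trans (minConv-≤ s (argminPeriodic n (conv s′))) (pointwise _)

    maxConv-staircase : IsStaircase n k maxConv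
    maxConv-staircase = extremum-staircase λ {s} {s′} C pointwise →
      ≤-trans (pointwise _) (+-monoˡ-≤ C (≤-maxConv s′ (argmaxPeriodic n (conv s))))

    private
      D = + n - + k

    -- For r > n - k, g loses at most r - (n - k) over that many steps, and f gains at least as
    -- much over r steps because it gains exactly k over n.
    conv-gap-within : ∀ a b {r} → 0ℤ ≤ r → r < + n → f a + g b ≤ f (a + r) + g (b + D - r)
    conv-gap-within a b {r} 0≤r r<n with ≤-total r D
    ... | inj₁ r≤D = begin
      f a + g b                 ≤⟨ +-mono-≤ (F.mono-+ a 0≤r) (G.mono-+ b (i≤j⇒0≤j-i r≤D)) ⟩
      f (a + r) + g (b + (D - r)) ≡⟨ cong (λ x → f (a + r) + g x) (eq₁ b D r) ⟩
      f (a + r) + g (b + D - r) ∎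
      where
        open ≤-Reasoning
        eq₁ : ∀ b D r → b + (D - r) ≡ b + D - r
        eq₁ = solve-∀
    ... | inj₂ D≤r = begin
      f a + g b                         ≡⟨ cong (λ x → f a + g x) (eq₁ b D r) ⟩
      f a + g (b + D - r + (r - D))     ≤⟨ +-monoʳ-≤ (f a) (G.slope-+ (b + D - r) (i≤j⇒0≤j-i D≤r)) ⟩
      f a + (g (b + D - r) + (r - D))   ≡⟨ eq₂ (f a) (g (b + D - r)) (r - D) ⟩
      f a + (r - D) + g (b + D - r)     ≤⟨ +-monoˡ-≤ (g (b + D - r)) f-gain ⟩
      f (a + r) + g (b + D - r)         ∎
      where
        open ≤-Reasoning
        eq₁ : ∀ b D r → b ≡ b + D - r + (r - D)
        eq₁ = solve-∀
        eq₂ : ∀ x y w → x + (y + w) ≡ x + w + y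
        eq₂ = solve-∀
        eq₃ : ∀ x r n k → x + (r - (n - k)) ≡ x + k + r - n
        eq₃ = solve-∀
        eq₄ : ∀ a r n → a + n ≡ a + r + (n - r)
        eq₄ = solve-∀
        eq₅ : ∀ y r n → y + (n - r) + r - n ≡ y
        eq₅ = solve-∀
        f-gain : f a + (r - D) ≤ f (a + r)
        f-gain = begin
          f a + (r - D)                       ≡⟨ eq₃ (f a) r (+ n) (+ k) ⟩
          f a + + k + r - + n                 ≡⟨ cong (λ x → x + r - + n) (F.shift a) ⟨
          f (a + + n) + r - + n               ≡⟨ cong (λ x → f x + r - + n) (eq₄ a r (+ n)) ⟩
          f (a + r + (+ n - r)) + r - + n     ≤⟨ +-monoˡ-≤ (- + n) (+-monoˡ-≤ r
                                                   (F.slope-+ (a + r) (i≤j⇒0≤j-i (<⇒≤ r<n)))) ⟩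
          f (a + r) + (+ n - r) + r - + n     ≡⟨ eq₅ (f (a + r)) r (+ n) ⟩
          f (a + r)                           ∎

    conv-gap : ∀ a b a′ b′ → a′ + b′ ≡ a + b + D → f a + g b ≤ f a′ + g b′
    conv-gap a b a′ b′ sum = begin
      f a + g b                                   ≤⟨ conv-gap-within a b (+≤+ z≤n) (+<+ (n%ℕd<d (a′ - a) n)) ⟩
      f (a + r) + g (b + D - r)                   ≡⟨ eq₁ (f (a + r)) (g (b + D - r)) q (+ k) ⟩
      f (a + r) + q * + k + (g (b + D - r) + - q * + k)
                                                  ≡⟨ cong₂ _+_ (F.shift-* (a + r) q) (G.shift-* (b + D - r) (- q)) ⟨
      f (a + r + q * + n) + g (b + D - r + - q * + n) ≡⟨ cong₂ (λ x y → f x + g y) a′≡ b′≡ ⟨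
      f a′ + g b′                                 ∎
      where
        open ≤-Reasoning
        r = + ((a′ - a) %ℕ n)
        q = (a′ - a) /ℕ n
        eq₁ : ∀ x y q k → x + y ≡ x + q * k + (y + - q * k)
        eq₁ = solve-∀
        eq₂ : ∀ a a′ → a′ ≡ a + (a′ - a)
        eq₂ = solve-∀
        eq₃ : ∀ a r x → a + (r + x) ≡ a + r + x
        eq₃ = solve-∀
        eq₄ : ∀ a′ b′ → b′ ≡ a′ + b′ - a′
        eq₄ = solve-∀
        eq₅ : ∀ a b D r q n → a + b + D - (a + r + q * n) ≡ b + D - r + - q * n
        eq₅ = solve-∀
        a′≡ : a′ ≡ a + r + q * + n
        a′≡ = trans (eq₂ a a′)
                (trans (cong (λ x → a + x) (a≡a%ℕn+[a/ℕn]*n (a′ - a) n)) (eq₃ a r (q * + n)))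
        b′≡ : b′ ≡ b + D - r + - q * + n
        b′≡ = trans (eq₄ a′ b′) (trans (cong₂ _-_ sum a′≡) (eq₅ a b D r q (+ n)))

  module _ {n k : ℕ} {f g : ℤ → ℤ} (Sf : IsStaircase n k f) (Sg : IsStaircase n k g) where
    private
      module F = IsStaircase Sf
      module G = IsStaircase Sg

    ⊓-staircase : IsStaircase n k (λ i → f i ⊓ g i)
    ⊓-staircase = record
      { mono   = λ i → ⊓-mono-≤ (F.mono i) (G.mono i)
      ; step≤1 = λ i → ≤-trans (⊓-mono-≤ (F.step≤1 i) (G.step≤1 i))
                               (≤-reflexive (sym (mono-≤-distrib-⊓ (+-monoʳ-≤ 1ℤ) (f i) (g i))))
      ; shift  = λ i → trans (cong₂ _⊓_ (F.shift i) (G.shift i))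
                             (sym (mono-≤-distrib-⊓ (+-monoˡ-≤ (+ k)) (f i) (g i)))
      }

    ⊔-staircase : IsStaircase n k (λ i → f i ⊔ g i)
    ⊔-staircase = record
      { mono   = λ i → ⊔-mono-≤ (F.mono i) (G.mono i)
      ; step≤1 = λ i → ≤-trans (⊔-mono-≤ (F.step≤1 i) (G.step≤1 i))
                               (≤-reflexive (sym (mono-≤-distrib-⊔ (+-monoʳ-≤ 1ℤ) (f i) (g i))))
      ; shift  = λ i → trans (cong₂ _⊔_ (F.shift i) (G.shift i))
                             (sym (mono-≤-distrib-⊔ (+-monoˡ-≤ (+ k)) (f i) (g i)))
      }

  reflect-staircase : ∀ {n k f} → IsStaircase n k f → ∀ e t → IsStaircase n k (λ c → e - f (t - c))
  reflect-staircase {n} {k} {f} Sf e t = record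
    { mono   = λ c → +-monoʳ-≤ e (neg-mono-≤ (subst (λ x → f (t - sucℤ c) ≤ f x) (predecessor t c) (F.mono _)))
    ; step≤1 = λ c → begin
        e - f (t - sucℤ c)              ≡⟨ eq₁ e (f (t - sucℤ c)) ⟩
        1ℤ + e - (1ℤ + f (t - sucℤ c))  ≤⟨ +-monoʳ-≤ (1ℤ + e) (neg-mono-≤ (F.step≤1 (t - sucℤ c))) ⟩
        1ℤ + e - f (1ℤ + (t - sucℤ c))  ≡⟨ cong (λ x → 1ℤ + e - f x) (predecessor t c) ⟩
        1ℤ + e - f (t - c)              ≡⟨ +-assoc 1ℤ e (- f (t - c)) ⟩
        1ℤ + (e - f (t - c))            ∎
    ; shift  = λ c → begin-equality
        e - f (t - (c + + n))           ≡⟨ cong (λ x → e - f x) (eq₂ t c (+ n)) ⟩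
        e - f (t - c + -1ℤ * + n)       ≡⟨ cong (λ x → e - x) (F.shift-* (t - c) -1ℤ) ⟩
        e - (f (t - c) + -1ℤ * + k)     ≡⟨ eq₃ e (f (t - c)) (+ k) ⟩
        e - f (t - c) + + k             ∎
    }
    where
      module F = Staircase Sf
      open ≤-Reasoning
      predecessor : ∀ t c → 1ℤ + (t - (1ℤ + c)) ≡ t - c
      predecessor = solve-∀
      eq₁ : ∀ e x → e - x ≡ 1ℤ + e - (1ℤ + x)
      eq₁ = solve-∀
      eq₂ : ∀ t c n → t - (c + n) ≡ t - c + -1ℤ * n
      eq₂ = solve-∀
      eq₃ : ∀ e x k → e - (x + -1ℤ * k) ≡ e - x + k
      eq₃ = solve-∀

  module _ {k m : ℕ} (k≤n : k ℕ.≤ suc m) where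
    private
      n = suc m

    φ-staircase : (λ' : Partition k n) → IsStaircase n k (φ λ')
    φ-staircase λ' = extend-staircase n k refl (φℕ-n λ' k≤n) (φℕ-mono λ') (φℕ-step≤1 λ')

    staircase-φ : ∀ {ψ} → IsStaircase n k ψ → ψ 0ℤ ≡ 0ℤ → ∃[ ν ] (∀ i → φ ν i ≡ ψ i)
    staircase-φ {ψ} Sψ ψ-0 = ν , φν≡ψ
      where
        module Ψ = Staircase Sψ
        F : ℕ → ℕ
        F j = ∣ ψ (+ j) ∣
        +F≡ψ : ∀ j → + F j ≡ ψ (+ j)
        +F≡ψ j = 0≤i⇒+∣i∣≡i (subst (_≤ ψ (+ j)) ψ-0 (Ψ.mono-+ 0ℤ (+≤+ z≤n)))
        F-mono : ∀ j → F j ℕ.≤ F (suc j)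
        F-mono j = drop‿+≤+ (subst₂ _≤_ (sym (+F≡ψ j)) (sym (+F≡ψ (suc j))) (Ψ.mono (+ j)))
        F-step : ∀ j → F (suc j) ℕ.≤ suc (F j)
        F-step j = drop‿+≤+ (subst₂ _≤_ (sym (+F≡ψ (suc j))) (cong sucℤ (sym (+F≡ψ j))) (Ψ.step≤1 (+ j)))
        F-n : F n ≡ k
        F-n = cong ∣_∣ (trans (Ψ.shift 0ℤ) (cong (_+ + k) ψ-0))
        open LatticePath k≤n F (cong ∣_∣ ψ-0) F-mono F-step F-n using (pathPartition; φℕ-pathPartition)
        ν = pathPartition
        φν≡ψ : ∀ i → φ ν i ≡ ψ i
        φν≡ψ i = begin
          + φℕ ν r + q * + k  ≡⟨ cong (λ x → + x + q * + k) (φℕ-pathPartition r (ℕP.<⇒≤ (n%ℕd<d i n))) ⟩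
          + F r + q * + k     ≡⟨ cong (_+ q * + k) (+F≡ψ r) ⟩
          ψ (+ r) + q * + k   ≡⟨ Ψ.shift-* (+ r) q ⟨
          ψ (+ r + q * + n)   ≡⟨ cong ψ (a≡a%ℕn+[a/ℕn]*n i n) ⟨
          ψ i                 ∎
          where
            open ≡-Reasoning
            r = i %ℕ n
            q = i /ℕ n

  module _ {k m : ℕ} (k≤n : k ℕ.≤ suc m) (λ' μ : Partition k (suc m)) (d : ℤ) where
    private
      n = suc m
      f = φ λ'
      g = φ μ
      Sf = φ-staircase k≤n λ'
      open Convolution Sf (φ-staircase k≤n μ)

      lower-bound : ∀ {e x y z} → e - y ≤ z → y ≤ x → e ≤ x + z
      lower-bound {e} {x} {y} {z} e-y≤z y≤x = begin
        e           ≡⟨ eq e y ⟩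
        e - y + y   ≤⟨ +-mono-≤ e-y≤z y≤x ⟩
        z + x       ≡⟨ +-comm z x ⟩
        x + z       ∎
        where
          open ≤-Reasoning
          eq : ∀ e y → e ≡ e - y + y
          eq = solve-∀

      upper-bound : ∀ {e x y z} → z ≤ e - y → x ≤ y → x + z ≤ e
      upper-bound {e} {x} {y} {z} z≤e-y x≤y = begin
        x + z       ≤⟨ +-mono-≤ x≤y z≤e-y ⟩
        y + (e - y) ≡⟨ eq e y ⟩
        e           ∎
        where
          open ≤-Reasoning
          eq : ∀ e y → y + (e - y) ≡ e
          eq = solve-∀

    L U ψ : ℤ → ℤ
    L c = - d - minConv (0ℤ - c)
    U c = - d - maxConv (+ k - + n - c)
    ψ c = L c ⊔ (U c ⊓ f c)

    ψ-staircase : IsStaircase n k ψ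
    ψ-staircase = ⊔-staircase (reflect-staircase minConv-staircase (- d) 0ℤ)
                              (⊓-staircase (reflect-staircase maxConv-staircase (- d) (+ k - + n)) Sf)

    L≤U : ∀ c → L c ≤ U c
    L≤U c = +-monoʳ-≤ (- d) (neg-mono-≤ (conv-gap a₁ (s - a₁) a₀ (0ℤ - c - a₀) (eq a₀ a₁ c (+ k) (+ n))))
      where
        s = + k - + n - c
        a₀ = argminPeriodic n (conv (0ℤ - c))
        a₁ = argmaxPeriodic n (conv s)
        eq : ∀ a₀ a₁ c k n → a₀ + (0ℤ - c - a₀) ≡ a₁ + (k - n - c - a₁) + (n - k)
        eq = solve-∀

    L0≤0 : (∀ i j → i + j ≡ 0ℤ → - d ≤ f i + g j) → L 0ℤ ≤ 0ℤ
    L0≤0 lower = i≤j⇒i-j≤0 (lower a₀ (0ℤ - 0ℤ - a₀) (eq a₀))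
      where
        a₀ = argminPeriodic n (conv (0ℤ - 0ℤ))
        eq : ∀ a → a + (0ℤ - 0ℤ - a) ≡ 0ℤ
        eq = solve-∀

    0≤U0 : (∀ i j → i + j ≡ + k - + n → f i + g j ≤ - d) → 0ℤ ≤ U 0ℤ
    0≤U0 upper = i≤j⇒0≤j-i (upper a₁ (+ k - + n - 0ℤ - a₁) (eq a₁ (+ k - + n)))
      where
        a₁ = argmaxPeriodic n (conv (+ k - + n - 0ℤ))
        eq : ∀ a s → a + (s - 0ℤ - a) ≡ s
        eq = solve-∀

    private
      solve-for-b : ∀ a b c {s} → a + b + c ≡ s → s - c - a ≡ b
      solve-for-b a b c refl = sym (eq a b c)
        where
          eq : ∀ a b c → b ≡ a + b + c - c - a
          eq = solve-∀

    above-L : ∀ {h : ℤ → ℤ} → (∀ c → L c ≤ h c) → ∀ a b c → a + b + c ≡ 0ℤ → - d ≤ f a + g b + h c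
    above-L L≤h a b c sum = lower-bound {y = minConv (0ℤ - c)} (L≤h c)
      (subst (λ b → minConv (0ℤ - c) ≤ f a + g b) (solve-for-b a b c sum) (minConv-≤ (0ℤ - c) a))

    below-U : ∀ {h : ℤ → ℤ} → (∀ c → h c ≤ U c) → ∀ a b c → a + b + c ≡ + k - + n → f a + g b + h c ≤ - d
    below-U h≤U a b c sum = upper-bound {y = maxConv s} (h≤U c)
      (subst (λ b → f a + g b ≤ maxConv s) (solve-for-b a b c sum) (≤-maxConv s a))
      where s = + k - + n - c

    Ind⇒InD : ∀ {ν} → Ind λ' μ ν d → InD λ' μ d
    Ind⇒InD {ν} (lower , upper) =
        (λ i j i+j≡0 → subst (- d ≤_) (+-identityʳ _) (lower i j 0ℤ (trans (+-identityʳ _) i+j≡0)))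
      , (λ i j i+j≡k-n → subst (_≤ - d) (+-identityʳ _) (upper i j 0ℤ (trans (+-identityʳ _) i+j≡k-n)))

    InD⇒Ind : InD λ' μ d → ∃[ ν ] Ind λ' μ ν d
    InD⇒Ind (lower , upper) = ν , above-L L≤φν , below-U φν≤U
      where
        ψ-0 : ψ 0ℤ ≡ 0ℤ
        ψ-0 = trans (cong (L 0ℤ ⊔_) (i≥j⇒i⊓j≡j (0≤U0 upper))) (i≤j⇒i⊔j≡j (L0≤0 lower))
        νψ : ∃[ ν ] (∀ i → φ ν i ≡ ψ i)
        νψ = staircase-φ k≤n ψ-staircase ψ-0
        ν : Partition k n
        ν = proj₁ νψ
        L≤φν : ∀ c → L c ≤ φ ν c
        L≤φν c = subst (L c ≤_) (sym (proj₂ νψ c)) (i≤i⊔j (L c) (U c ⊓ f c))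
        φν≤U : ∀ c → φ ν c ≤ U c
        φν≤U c = subst (_≤ U c) (sym (proj₂ νψ c)) (⊔-lub (L≤U c) (i⊓j≤i (U c) (f c)))

    InD⇔∃Ind : InD λ' μ d ⇔ (∃[ ν ] Ind λ' μ ν d)
    InD⇔∃Ind = mk⇔ InD⇒Ind (λ (_ , ind) → Ind⇒InD ind)

open import Data.Nat using (_≤_; _<_)
open import Data.Integer using (ℤ)

corollary8p2 : (k n : ℕ) → 1 ≤ k → k < n → (λ' μ : Partition k n) →
    (d : ℤ) → InD λ' μ d ⇔ (∃[ ν ] Ind λ' μ ν d)
corollary8p2 k (suc m) _ (s≤s k≤m) = InD⇔∃Ind (ℕP.m≤n⇒m≤1+n k≤m)
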